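{- For all integers $p,q\geq 1$ there exists a shiftable $SMR(2q,4pq;4p,2)$.
   Context: A signed magic rectangle $SMR(m,n;r,s)$ is an $m\times n$ array, some of whose cells are filled with integers and the others empty, such that exactly $r$ cells in every row and exactly $s$ cells in every column are filled (so $mr=ns$), every element of $X$ appears exactly once in the array, and the sum of the entries of each row and of each column is zero, where (for $mr$ even) $X=\{\pm1,\pm2,\ldots,\pm mr/2\}$. An array is shiftable if every row and every column contains the same number of positive entries as negative entries. -}

module Defs where

open import Data.Nat using (ℕ; zero; suc; _*_; _≤_)
open import Data.Nat.DivMod using (_/_)
open import Data.Integer using (ℤ; +_; ∣_∣; _<_; _+_)
open import Data.Integer using () renaming (_<?_ to _<ℤ?_)
open import Data.Fin using (Fin; zero; suc)
open import Data.Maybe using (Maybe; just; nothing; is-just)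
open import Data.Bool using (Bool; true; false; if_then_else_)
open import Data.Product using (_×_; Σ; _,_)
open import Relation.Binary.PropositionalEquality using (_≡_)
open import Relation.Nullary using (¬_)
open import Relation.Nullary.Decidable using (⌊_⌋)

-- A partially filled m × n array of integers: nothing = empty cell.
Array : ℕ → ℕ → Set
Array m n = Fin m → Fin n → Maybe ℤ

sumFin : ∀ {n} → (Fin n → ℤ) → ℤ
sumFin {zero} f = + 0
sumFin {suc n} f = f zero + sumFin (λ i → f (suc i))

countFin : ∀ {n} → (Fin n → Bool) → ℕ
countFin {zero} b = 0
countFin {suc n} b = (if b zero then 1 else 0) Data.Nat.+ countFin (λ i → b (suc i))

val : Maybe ℤ → ℤ
val (just x) = x
val nothing = + 0

isPos : Maybe ℤ → Bool
isPos (just x) = ⌊ + 0 <ℤ? x ⌋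
isPos nothing = false

isNeg : Maybe ℤ → Bool
isNeg (just x) = ⌊ x <ℤ? + 0 ⌋
isNeg nothing = false

InX : ℕ → ℤ → Set
InX N x = ¬ (x ≡ + 0) × ∣ x ∣ ≤ N

record IsSMR (m n r s : ℕ) (A : Array m n) : Set where
  field
    rowFilled : ∀ i → countFin (λ j → is-just (A i j)) ≡ r
    colFilled : ∀ j → countFin (λ i → is-just (A i j)) ≡ s
    entriesInX : ∀ i j x → A i j ≡ just x → InX ((m * r) / 2) x
    appearsOnce : ∀ x → InX ((m * r) / 2) x →
      Σ (Fin m) λ i → Σ (Fin n) λ j → (A i j ≡ just x) ×
        (∀ i′ j′ → A i′ j′ ≡ just x → (i′ ≡ i) × (j′ ≡ j))
    rowSum : ∀ i → sumFin (λ j → val (A i j)) ≡ + 0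
    colSum : ∀ j → sumFin (λ i → val (A i j)) ≡ + 0

record Shiftable {m n : ℕ} (A : Array m n) : Set where
  field
    rowBalanced : ∀ i → countFin (λ j → isPos (A i j)) ≡ countFin (λ j → isNeg (A i j))
    colBalanced : ∀ j → countFin (λ i → isPos (A i j)) ≡ countFin (λ i → isNeg (A i j))

module Submission where

-- Rows k and q + k form a pair that fills exactly the 4p columns j ≡ k (mod q); the
-- column j holds j + 1 in one row of the pair and -(j + 1) in the other, so every column
-- sums to zero with one entry of each sign. Along a row the signs follow + − − + on
-- quadruples of columns in arithmetic progression, and a − (a + d) − (a + 2d) + (a + 3d) = 0,
-- so each row splits into p balanced quadruples.

open import Algebra.Bundles using (CommutativeMonoid)
import Algebra.Properties.CommutativeMonoid.Sum as CommutativeMonoidSum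
open import Data.Bool using (Bool; true; false; not; if_then_else_)
import Data.Bool.Properties as Bool
open import Data.Fin using (Fin; suc; toℕ; fromℕ<; combine; remQuot; quotient; _↑ˡ_; _↑ʳ_; punchIn)
open import Data.Fin.Patterns using (0F; 1F; 2F; 3F)
open import Data.Fin.Properties
  using (_≟_; punchInᵢ≢i; remQuot-combine; combine-remQuot; toℕ-combine; toℕ-fromℕ<; toℕ<n; toℕ-injective)
open import Data.Integer as ℤ using (ℤ; +_; -[1+_]; -_; _+_; _-_; ∣_∣)
import Data.Integer.Properties as ℤ
open import Data.Integer.Tactic.RingSolver using (solve-∀)
open import Data.Maybe using (Maybe; just; nothing; is-just)
open import Data.Nat as ℕ using (ℕ; _*_; _≤_; _<_)
import Data.Nat.Properties as ℕ
open import Data.Nat.DivMod using (_/_; m*n/n≡m)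
import Data.Nat.Tactic.RingSolver as ℕ-Solver
open import Data.Product using (Σ; ∃-syntax; _×_; _,_; proj₁; proj₂; uncurry)
open import Function using (_∘_)
open import Relation.Binary.PropositionalEquality
open import Relation.Nullary using (yes; no; does; contradiction)
open import Relation.Nullary.Decidable using (dec-true; dec-false)

open import Defs

module _ {c ℓ} (M : CommutativeMonoid c ℓ) where

  open CommutativeMonoid M using (Carrier; _≈_; _∙_; ε; ∙-congˡ; identityˡ; identityʳ; assoc)
    renaming (refl to ≈-refl; sym to ≈-sym; trans to ≈-trans)
  open CommutativeMonoidSum M
  open import Relation.Binary.Reasoning.Setoid (CommutativeMonoid.setoid M)

  sum-↑ : ∀ m {n} (f : Fin (m ℕ.+ n) → Carrier) →
          sum f ≈ sum (f ∘ (_↑ˡ n)) ∙ sum (f ∘ (m ↑ʳ_))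
  sum-↑ ℕ.zero    f = ≈-sym (identityˡ _)
  sum-↑ (ℕ.suc m) f = ≈-trans (∙-congˡ (sum-↑ m (f ∘ suc))) (≈-sym (assoc _ _ _))

  sum-combine : ∀ m {n} (f : Fin (m * n) → Carrier) →
                sum f ≈ ∑[ i < m ] ∑[ j < n ] f (combine i j)
  sum-combine ℕ.zero        f = ≈-refl
  sum-combine (ℕ.suc m) {n} f = ≈-trans (sum-↑ n f) (∙-congˡ (sum-combine m (f ∘ (n ↑ʳ_))))

  sum-cong-fibres : ∀ m n (f g : Fin (m * n) → Carrier) →
                    (∀ j → ∑[ i < m ] f (combine i j) ≈ ∑[ i < m ] g (combine i j)) →
                    sum f ≈ sum g
  sum-cong-fibres m n f g fibres = begin
    sum f                                 ≈⟨ sum-combine m f ⟩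
    ∑[ i < m ] ∑[ j < n ] f (combine i j) ≈⟨ ∑-comm {m} {n} (λ i j → f (combine i j)) ⟩
    ∑[ j < n ] ∑[ i < m ] f (combine i j) ≈⟨ sum-cong-≋ fibres ⟩
    ∑[ j < n ] ∑[ i < m ] g (combine i j) ≈⟨ ∑-comm {m} {n} (λ i j → g (combine i j)) ⟨
    ∑[ i < m ] ∑[ j < n ] g (combine i j) ≈⟨ sum-combine m g ⟨
    sum g                                 ∎

  sum-supported : ∀ {n} (k : Fin n) (f : Fin n → Carrier) →
                  (∀ i → i ≢ k → f i ≈ ε) → sum f ≈ f k
  sum-supported {ℕ.suc n} k f off = begin
    sum f                          ≈⟨ sum-remove f ⟩
    f k ∙ sum (f ∘ punchIn k)      ≈⟨ ∙-congˡ (sum-cong-≋ (λ i → off (punchIn k i) (punchInᵢ≢i k i))) ⟩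
    f k ∙ sum (λ (_ : Fin n) → ε)  ≈⟨ ∙-congˡ (sum-replicate-zero n) ⟩
    f k ∙ ε                        ≈⟨ identityʳ (f k) ⟩
    f k                            ∎

module ℕ∑ = CommutativeMonoidSum ℕ.+-0-commutativeMonoid
module ℤ∑ = CommutativeMonoidSum ℤ.+-0-commutativeMonoid

indicator : Bool → ℕ
indicator b = if b then 1 else 0

countFin≡∑ : ∀ {n} (b : Fin n → Bool) → countFin b ≡ ℕ∑.sum (indicator ∘ b)
countFin≡∑ {ℕ.zero}  b = refl
countFin≡∑ {ℕ.suc n} b = cong (indicator (b 0F) ℕ.+_) (countFin≡∑ (b ∘ suc))

sumFin≡∑ : ∀ {n} (f : Fin n → ℤ) → sumFin f ≡ ℤ∑.sum f
sumFin≡∑ {ℕ.zero}  f = refl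
sumFin≡∑ {ℕ.suc n} f = cong (λ x → f 0F + x) (sumFin≡∑ (f ∘ suc))

∑-ones : ∀ n → ℕ∑.sum (λ (_ : Fin n) → 1) ≡ n
∑-ones ℕ.zero    = refl
∑-ones (ℕ.suc n) = cong ℕ.suc (∑-ones n)

signed : Bool → ℕ → ℤ
signed true  n = + ℕ.suc n
signed false n = -[1+ n ]

signed-injective : ∀ {s s′ m n} → signed s m ≡ signed s′ n → s ≡ s′ × m ≡ n
signed-injective {true}  {true}  refl = refl , refl
signed-injective {false} {false} refl = refl , refl

signed≢0 : ∀ s n → signed s n ≢ + 0
signed≢0 true  n ()
signed≢0 false n ()

∣signed∣ : ∀ s n → ∣ signed s n ∣ ≡ ℕ.suc n
∣signed∣ true  n = refl
∣signed∣ false n = refl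

isPos-signed : ∀ s n → isPos (just (signed s n)) ≡ s
isPos-signed true  n = refl
isPos-signed false n = refl

isNeg-signed : ∀ s n → isNeg (just (signed s n)) ≡ not s
isNeg-signed true  n = refl
isNeg-signed false n = refl

signed-pair-cancel : ∀ s n → signed s n + (signed (not s) n + + 0) ≡ + 0
signed-pair-cancel true  n = cancel (+ ℕ.suc n)
  where
  cancel : ∀ x → x + (- x + + 0) ≡ + 0
  cancel = solve-∀
signed-pair-cancel false n = cancel (+ ℕ.suc n)
  where
  cancel : ∀ x → - x + (x + + 0) ≡ + 0
  cancel = solve-∀

signed-pair-balanced : ∀ s n →
  indicator (isPos (just (signed s n))) ℕ.+ (indicator (isPos (just (signed (not s) n))) ℕ.+ 0) ≡
  indicator (isNeg (just (signed s n))) ℕ.+ (indicator (isNeg (just (signed (not s) n))) ℕ.+ 0)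
signed-pair-balanced true  n = refl
signed-pair-balanced false n = refl

alternating-zero : ∀ a b c d → a ℕ.+ d ≡ b ℕ.+ c →
  signed true a + (signed false b + (signed false c + (signed true d + + 0))) ≡ + 0
alternating-zero a b c d a+d≡b+c = begin
  x + (- y + (- z + (w + + 0))) ≡⟨ regroup x y z w ⟩
  (x + w) - (y + z)             ≡⟨ cong (λ n → + n - (y + z)) x+w≡y+z ⟩
  (y + z) - (y + z)             ≡⟨ ℤ.+-inverseʳ (y + z) ⟩
  + 0                           ∎
  where
  open ≡-Reasoning
  x = + ℕ.suc a
  y = + ℕ.suc b
  z = + ℕ.suc c
  w = + ℕ.suc d
  regroup : ∀ x y z w → x + (- y + (- z + (w + + 0))) ≡ (x + w) - (y + z)
  regroup = solve-∀
  x+w≡y+z : ℕ.suc a ℕ.+ ℕ.suc d ≡ ℕ.suc b ℕ.+ ℕ.suc c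
  x+w≡y+z = cong ℕ.suc (trans (ℕ.+-suc a d) (trans (cong ℕ.suc a+d≡b+c) (sym (ℕ.+-suc b c))))

signed-alternating-zero : ∀ s a b c d → a ℕ.+ d ≡ b ℕ.+ c →
  signed s a + (signed (not s) b + (signed (not s) c + (signed s d + + 0))) ≡ + 0
signed-alternating-zero true  a b c d e = alternating-zero a b c d e
signed-alternating-zero false a b c d e =
  trans (negate (+ ℕ.suc a) (+ ℕ.suc b) (+ ℕ.suc c) (+ ℕ.suc d)) (cong -_ (alternating-zero a b c d e))
  where
  negate : ∀ x y z w → - x + (y + (z + (- w + + 0))) ≡ - (x + (- y + (- z + (w + + 0))))
  negate = solve-∀

quadrupleSign : Fin 4 → Bool
quadrupleSign 0F = true
quadrupleSign 1F = false
quadrupleSign 2F = false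
quadrupleSign 3F = true

signAt : Fin 2 → Fin 4 → Bool
signAt 0F u = quadrupleSign u
signAt 1F u = not (quadrupleSign u)

signAt-surjective : ∀ u s → ∃[ b ] signAt b u ≡ s
signAt-surjective u s with quadrupleSign u Bool.≟ s
... | yes σ≡s = 0F , σ≡s
... | no  σ≢s = 1F , sym (Bool.¬-not (σ≢s ∘ sym))

signAt-injective : ∀ {b b′} u → signAt b u ≡ signAt b′ u → b ≡ b′
signAt-injective {0F} {0F} u _ = refl
signAt-injective {0F} {1F} u e = contradiction e (Bool.not-¬ refl)
signAt-injective {1F} {0F} u e = contradiction (sym e) (Bool.not-¬ refl)
signAt-injective {1F} {1F} u _ = refl

signAt-balanced : ∀ b → ℕ∑.sum (λ u → indicator (signAt b u)) ≡ ℕ∑.sum (λ u → indicator (not (signAt b u)))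
signAt-balanced 0F = refl
signAt-balanced 1F = refl

signAt-alternating-zero : ∀ b (v : Fin 4 → ℕ) → v 0F ℕ.+ v 3F ≡ v 1F ℕ.+ v 2F →
  ℤ∑.sum (λ u → signed (signAt b u) (v u)) ≡ + 0
signAt-alternating-zero 0F v e = signed-alternating-zero true  (v 0F) (v 1F) (v 2F) (v 3F) e
signAt-alternating-zero 1F v e = signed-alternating-zero false (v 0F) (v 1F) (v 2F) (v 3F) e

module Construction (p q : ℕ) where

  -- Row combine b k and column combine t k′ meet in a filled cell iff k ≡ k′; the sign
  -- there is signAt b applied to the Fin 4 digit of t = combine u r, and the value is ±(j + 1).
  rowIndex : Fin (2 * q) → Fin 2 × Fin q
  rowIndex = remQuot q

  columnIndex : Fin (4 * p * q) → Fin (4 * p) × Fin q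
  columnIndex = remQuot q

  phase : Fin (4 * p) → Fin 4
  phase = quotient p

  columnSign : Fin (4 * p * q) → Bool
  columnSign j = quadrupleSign (phase (proj₁ (columnIndex j)))

  entry : Fin 2 × Fin q → Fin (4 * p) × Fin q → ℕ → Maybe ℤ
  entry (b , k) (t , k′) n = if does (k ≟ k′) then just (signed (signAt b (phase t)) n) else nothing

  A : Array (2 * q) (4 * p * q)
  A i j = entry (rowIndex i) (columnIndex j) (toℕ j)

  entry-diagonal : ∀ b k t n → entry (b , k) (t , k) n ≡ just (signed (signAt b (phase t)) n)
  entry-diagonal b k t n rewrite dec-true (k ≟ k) refl = refl

  entry-offDiagonal : ∀ b {k k′} t n → k ≢ k′ → entry (b , k) (t , k′) n ≡ nothing
  entry-offDiagonal b {k} {k′} t n k≢k′ rewrite dec-false (k ≟ k′) k≢k′ = refl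

  entry-just : ∀ b k t k′ n {x} → entry (b , k) (t , k′) n ≡ just x →
               k ≡ k′ × x ≡ signed (signAt b (phase t)) n
  entry-just b k t k′ n e with k ≟ k′
  entry-just b k t k′ n refl | yes k≡k′ = k≡k′ , refl

  A-just : ∀ i j {x} → A i j ≡ just x →
    proj₂ (rowIndex i) ≡ proj₂ (columnIndex j) ×
    x ≡ signed (signAt (proj₁ (rowIndex i)) (phase (proj₁ (columnIndex j)))) (toℕ j)
  A-just i j = entry-just (proj₁ (rowIndex i)) (proj₂ (rowIndex i))
                          (proj₁ (columnIndex j)) (proj₂ (columnIndex j)) (toℕ j)

  A-combineʳ : ∀ i t k′ → A i (combine t k′) ≡ entry (rowIndex i) (t , k′) (toℕ (combine t k′))
  A-combineʳ i t k′ = cong (λ c → entry (rowIndex i) c (toℕ (combine t k′))) (remQuot-combine t k′)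

  A-combineˡ : ∀ b k j → A (combine b k) j ≡ entry (b , k) (columnIndex j) (toℕ j)
  A-combineˡ b k j = cong (λ r → entry r (columnIndex j) (toℕ j)) (remQuot-combine b k)

  A-row-diagonal : ∀ i t → let (b , k) = rowIndex i in
    A i (combine t k) ≡ just (signed (signAt b (phase t)) (toℕ (combine t k)))
  A-row-diagonal i t = trans (A-combineʳ i t k) (entry-diagonal b k t (toℕ (combine t k)))
    where
    b = proj₁ (rowIndex i)
    k = proj₂ (rowIndex i)

  A-row-offDiagonal : ∀ i t k′ → k′ ≢ proj₂ (rowIndex i) → A i (combine t k′) ≡ nothing
  A-row-offDiagonal i t k′ k′≢k =
    trans (A-combineʳ i t k′) (entry-offDiagonal (proj₁ (rowIndex i)) t (toℕ (combine t k′)) (k′≢k ∘ sym))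

  A-column-diagonal : ∀ b j → let (t , k′) = columnIndex j in
    A (combine b k′) j ≡ just (signed (signAt b (phase t)) (toℕ j))
  A-column-diagonal b j = trans (A-combineˡ b k′ j) (entry-diagonal b k′ t (toℕ j))
    where
    t  = proj₁ (columnIndex j)
    k′ = proj₂ (columnIndex j)

  A-column-offDiagonal : ∀ b k j → k ≢ proj₂ (columnIndex j) → A (combine b k) j ≡ nothing
  A-column-offDiagonal b k j k≢k′ =
    trans (A-combineˡ b k j) (entry-offDiagonal b (proj₁ (columnIndex j)) (toℕ j) k≢k′)

  module Totals {c ℓ} (M : CommutativeMonoid c ℓ) (h : Maybe ℤ → CommutativeMonoid.Carrier M)
                (h-nothing : CommutativeMonoid._≈_ M (h nothing) (CommutativeMonoid.ε M)) where

    open CommutativeMonoid M using (_≈_; _∙_; ε; reflexive) renaming (trans to ≈-trans)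
    open CommutativeMonoidSum M

    h-empty : ∀ {x} → x ≡ nothing → h x ≈ ε
    h-empty refl = h-nothing

    row-total : ∀ i → let (b , k) = rowIndex i in
      sum (λ j → h (A i j)) ≈ ∑[ t < 4 * p ] h (just (signed (signAt b (phase t)) (toℕ (combine t k))))
    row-total i = ≈-trans (sum-combine M (4 * p) {q} (λ j → h (A i j))) (sum-cong-≋ {4 * p} λ t →
      ≈-trans (sum-supported M (proj₂ (rowIndex i)) (λ k′ → h (A i (combine t k′)))
                             (λ k′ k′≢k → h-empty (A-row-offDiagonal i t k′ k′≢k)))
              (reflexive (cong h (A-row-diagonal i t))))

    column-total : ∀ j → let s = columnSign j in
      sum (λ i → h (A i j)) ≈ h (just (signed s (toℕ j))) ∙ (h (just (signed (not s) (toℕ j))) ∙ ε)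
    column-total j = ≈-trans (sum-combine M 2 {q} (λ i → h (A i j))) (sum-cong-≋ {2} λ b →
      ≈-trans (sum-supported M (proj₂ (columnIndex j)) (λ k → h (A (combine b k) j))
                             (λ k k≢k′ → h-empty (A-column-offDiagonal b k j k≢k′)))
              (reflexive (cong h (A-column-diagonal b j))))

  module Count (G : Maybe ℤ → Bool) (G-nothing : G nothing ≡ false) =
    Totals ℕ.+-0-commutativeMonoid (indicator ∘ G) (cong indicator G-nothing)
  module Sum = Totals ℤ.+-0-commutativeMonoid val refl

  phase-combine : ∀ (u : Fin 4) (r : Fin p) → phase (combine u r) ≡ u
  phase-combine u r = cong proj₁ (remQuot-combine u r)

  toℕ-combine-combine : ∀ (u : Fin 4) (r : Fin p) (k : Fin q) →
    toℕ (combine (combine u r) k) ≡ q * (p * toℕ u ℕ.+ toℕ r) ℕ.+ toℕ k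
  toℕ-combine-combine u r k =
    trans (toℕ-combine (combine u r) k) (cong (λ x → q * x ℕ.+ toℕ k) (toℕ-combine u r))

  row-values-sum-zero : ∀ b k → ℤ∑.sum (λ t → signed (signAt b (phase t)) (toℕ (combine t k))) ≡ + 0
  row-values-sum-zero b k = trans
    (sum-cong-fibres ℤ.+-0-commutativeMonoid 4 p (λ t → signed (signAt b (phase t)) (toℕ (combine t k)))
                     (λ _ → + 0) quadruple-zero)
    (ℤ∑.sum-replicate-zero (4 * p))
    where
    value : Fin p → Fin 4 → ℕ
    value r u = q * (p * toℕ u ℕ.+ toℕ r) ℕ.+ toℕ k
    arithmetic : ∀ p q r k → q * (p * 0 ℕ.+ r) ℕ.+ k ℕ.+ (q * (p * 3 ℕ.+ r) ℕ.+ k)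
                           ≡ q * (p * 1 ℕ.+ r) ℕ.+ k ℕ.+ (q * (p * 2 ℕ.+ r) ℕ.+ k)
    arithmetic = ℕ-Solver.solve-∀
    quadruple-zero : ∀ r →
      ℤ∑.sum {4} (λ u → signed (signAt b (phase (combine u r))) (toℕ (combine {4 * p} (combine u r) k))) ≡ + 0
    quadruple-zero r = trans
      (ℤ∑.sum-cong-≗ {4} (λ u → cong₂ (signed ∘ signAt b) (phase-combine u r) (toℕ-combine-combine u r k)))
      (signAt-alternating-zero b (value r) (arithmetic p q (toℕ r) (toℕ k)))

  row-signs-balanced : ∀ b →
    ℕ∑.sum (λ t → indicator (signAt b (phase t))) ≡ ℕ∑.sum (λ t → indicator (not (signAt b (phase t))))
  row-signs-balanced b = sum-cong-fibres ℕ.+-0-commutativeMonoid 4 p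
    (λ t → indicator (signAt b (phase t))) (λ t → indicator (not (signAt b (phase t)))) λ r →
    trans (ℕ∑.sum-cong-≗ {4} (λ u → cong (indicator ∘ signAt b) (phase-combine u r)))
   (trans (signAt-balanced b)
          (sym (ℕ∑.sum-cong-≗ {4} (λ u → cong (indicator ∘ not ∘ signAt b) (phase-combine u r)))))

  row-count : ∀ (G : Maybe ℤ → Bool) (g : Bool → Bool) → G nothing ≡ false →
    (∀ s n → G (just (signed s n)) ≡ g s) →
    ∀ i → countFin (λ j → G (A i j)) ≡ ℕ∑.sum (λ t → indicator (g (signAt (proj₁ (rowIndex i)) (phase t))))
  row-count G g G-nothing G-signed i =
    trans (countFin≡∑ (λ j → G (A i j))) (trans (Count.row-total G G-nothing i)
          (ℕ∑.sum-cong-≗ (λ t → cong indicator (G-signed (signAt b (phase t)) (toℕ (combine t k))))))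
    where
    b = proj₁ (rowIndex i)
    k = proj₂ (rowIndex i)

  column-count : ∀ (G : Maybe ℤ → Bool) → G nothing ≡ false → ∀ j → let s = columnSign j in
    countFin (λ i → G (A i j)) ≡
    indicator (G (just (signed s (toℕ j)))) ℕ.+ (indicator (G (just (signed (not s) (toℕ j)))) ℕ.+ 0)
  column-count G G-nothing j = trans (countFin≡∑ (λ i → G (A i j))) (Count.column-total G G-nothing j)

  half-size : (2 * q * (4 * p)) / 2 ≡ 4 * p * q
  half-size = trans (cong (_/ 2) (reorder p q)) (m*n/n≡m (4 * p * q) 2)
    where
    reorder : ∀ p q → 2 * q * (4 * p) ≡ 4 * p * q * 2
    reorder = ℕ-Solver.solve-∀

  signed-InX : ∀ s {n} → n < 4 * p * q → InX ((2 * q * (4 * p)) / 2) (signed s n)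
  signed-InX s {n} n< = signed≢0 s n , subst₂ _≤_ (sym (∣signed∣ s n)) (sym half-size) n<

  rowIndex-injective : ∀ i {b k} → rowIndex i ≡ (b , k) → i ≡ combine b k
  rowIndex-injective i e = trans (sym (combine-remQuot {2} q i)) (cong (uncurry combine) e)

  UniqueCell : ℤ → Set
  UniqueCell x = Σ (Fin (2 * q)) λ i → Σ (Fin (4 * p * q)) λ j → (A i j ≡ just x) ×
    (∀ i′ j′ → A i′ j′ ≡ just x → (i′ ≡ i) × (j′ ≡ j))

  signed-uniqueCell : ∀ s {n} → n < 4 * p * q → UniqueCell (signed s n)
  signed-uniqueCell s {n} n< = combine b k , j , hit , unique
    where
    j = fromℕ< n<
    t = proj₁ (columnIndex j)
    k = proj₂ (columnIndex j)
    b = proj₁ (signAt-surjective (phase t) s)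
    hit : A (combine b k) j ≡ just (signed s n)
    hit = trans (A-column-diagonal b j)
                (cong₂ (λ s n → just (signed s n)) (proj₂ (signAt-surjective (phase t) s)) (toℕ-fromℕ< n<))
    unique : ∀ i′ j′ → A i′ j′ ≡ just (signed s n) → (i′ ≡ combine b k) × (j′ ≡ j)
    unique i′ j′ e with A-just i′ j′ e
    ... | k′≡k , x≡ with signed-injective x≡
    ... | s≡ , n≡ with refl ← toℕ-injective {i = j′} {j = j} (trans (sym n≡) (sym (toℕ-fromℕ< n<))) =
      rowIndex-injective i′ (cong₂ _,_ b′≡b k′≡k) , refl
      where
      b′≡b : proj₁ (rowIndex i′) ≡ b
      b′≡b = signAt-injective (phase t) (trans (sym s≡) (sym (proj₂ (signAt-surjective (phase t) s))))

  isSMR : IsSMR (2 * q) (4 * p * q) (4 * p) 2 A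
  isSMR = record
    { rowFilled   = λ i → trans (row-count is-just (λ _ → true) refl (λ _ _ → refl) i) (∑-ones (4 * p))
    ; colFilled   = column-count is-just refl
    ; entriesInX  = λ i j x e → subst (InX _) (sym (proj₂ (A-just i j e))) (signed-InX _ (toℕ<n j))
    ; appearsOnce = appearsOnce
    ; rowSum      = λ i → trans (sumFin≡∑ (λ j → val (A i j)))
                          (trans (Sum.row-total i) (row-values-sum-zero (proj₁ (rowIndex i)) (proj₂ (rowIndex i))))
    ; colSum      = λ j → trans (sumFin≡∑ (λ i → val (A i j)))
                          (trans (Sum.column-total j) (signed-pair-cancel (columnSign j) (toℕ j)))
    }
    where
    appearsOnce : ∀ x → InX ((2 * q * (4 * p)) / 2) x → UniqueCell x
    appearsOnce (+ ℕ.zero)  (x≢0 , _)  = contradiction refl x≢0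
    appearsOnce (+ ℕ.suc n) (_ , ∣x∣≤) = signed-uniqueCell true  (subst (ℕ.suc n ≤_) half-size ∣x∣≤)
    appearsOnce -[1+ n ]    (_ , ∣x∣≤) = signed-uniqueCell false (subst (ℕ.suc n ≤_) half-size ∣x∣≤)

  shiftable : Shiftable A
  shiftable = record
    { rowBalanced = λ i → trans (row-count isPos (λ s → s) refl isPos-signed i)
                          (trans (row-signs-balanced (proj₁ (rowIndex i)))
                                 (sym (row-count isNeg not refl isNeg-signed i)))
    ; colBalanced = λ j → trans (column-count isPos refl j)
                          (trans (signed-pair-balanced (columnSign j) (toℕ j)) (sym (column-count isNeg refl j)))
    }

lemma10 : ∀ (p q : ℕ) → 1 ≤ p → 1 ≤ q →
    Σ (Array (2 * q) (4 * p * q)) λ A →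
      IsSMR (2 * q) (4 * p * q) (4 * p) 2 A × Shiftable A
lemma10 p q _ _ = A , isSMR , shiftable
  where open Construction p q
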